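{- Let $M$ be an accordion with partition $(G,F,H)$ where $F$ is a maximal fan having even length at least four, and $G$ is a left-hand quad-type end of $F$. Suppose that $F$ has ordering $(e_1,e_2,\ldots,e_{|F|})$, and $G = \{a_1,a_2,b_1,b_2\}$, where $\{e_1,e_2,e_3\}$, $\{e_1,a_1,a_2\}$ and $\{e_1,b_1,b_2\}$ are triangles, and $\{e_1,e_2,a_1,b_1\}$ and $\{e_1,e_2,a_2,b_2\}$ are cocircuits. Then (i) $\sqcap(\{a_1,b_1\}, H) = \sqcap(\{a_2,b_2\}, H) = 1$, and (ii) $\sqcap^*(\{a_1,a_2\}, H) = \sqcap^*(\{b_1,b_2\}, H) = 1$.
   Context: $M$ is a $3$-connected matroid with rank function $r$ and dual rank function $r^*$. The local connectivity of $X,Y\subseteq E(M)$ is $\sqcap(X,Y)=r(X)+r(Y)-r(X\cup Y)$, and $\sqcap^*(X,Y)=r^*(X)+r^*(Y)-r^*(X\cup Y)$ is the local connectivity in the dual $M^*$. A triangle is a $3$-element circuit, a triad a $3$-element cocircuit, and a quad a $4$-element set that is both a circuit and a cocircuit. A fan is a set $F$ with $|F|\ge 3$ and an ordering $(e_1,\dots,e_{|F|})$ such that $\{e_1,e_2,e_3\}$ is a triangle or triad and, for each $i$, if $\{e_i,e_{i+1},e_{i+2}\}$ is a triangle then $\{e_{i+1},e_{i+2},e_{i+3}\}$ is a triad and vice versa (also any $2$-element set is a fan); a fan is maximal if it is not properly contained in another fan. Let $F=(e_1,\dots,e_{|F|})$ be a maximal fan of $M$ of even length at least four with $\{e_1,e_2,e_3\}$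 a triangle, and let $X\subseteq E(M)-F$ with $|E(M)|\ge |X\cup F|+2$. $X$ is a left-hand fan-type end of $F$ if $X\cup\{e_1\}$ is a maximal fan of length five with ordering $(e_1,g_2,g_3,g_4,g_5)$ such that $\{e_1,g_2,g_3\}$ is a triangle and $\{e_1,e_2,g_3,g_5\}$ is a cocircuit. $X$ is a left-hand quad-type end if $X=\{a_1,a_2,b_1,b_2\}$ is a quad such that $\{e_1,a_1,a_2\}$ and $\{e_1,b_1,b_2\}$ are triangles, each not contained in a $4$-element fan, and $\{e_1,e_2,a_1,b_1\}$, $\{e_1,e_2,a_2,b_2\}$ are cocircuits. $X$ is a left-hand triangle-type end if $X\cup\{e_1\}$ is a triangle not contained in a $4$-element fan and $X\cup\{e_1,e_2\}$ is a cocircuit. $X$ is a right-hand fan-type end of $F$ if $X\cup\{e_{|F|}\}$ is a maximal fan of length five with ordering $(e_{|F|},h_2,h_3,h_4,h_5)$ such that $\{e_{|F|},h_2,h_3\}$ is a triad and $\{e_{|F|-1},e_{|F|},h_3,h_5\}$ is a circuit. $X$ is a right-hand quad-type end if $X=\{c_1,c_2,d_1,d_2\}$ is a quad such that $\{e_{|F|},c_1,c_2\}$ and $\{e_{|F|},d_1,d_2\}$ are triads, each not contained in a $4$-element fan, and $\{e_{|F|-1},e_{|F|},c_1,d_1\}$, $\{e_{|F|-1},e_{|F|},c_2,d_2\}$ are circuits. $X$ is a right-hand triad-type end if $X\cup\{e_{|F|}\}$ is a triad not contained in a $4$-element fan and $X\cup\{e_{|F|-1},e_{|F|}\}$ is a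 circuit. $M$ is an accordion with partition $(G,F,H)$ if $(G,F,H)$ partitions $E(M)$, $F$ is a maximal fan of even length at least four, $G$ is a left-hand fan-type, quad-type, or triangle-type end of $F$, and $H$ is a right-hand fan-type, quad-type, or triad-type end of $F$. -}

module Defs where

open import Data.Nat using (ℕ; _+_; _∸_; _≤_; _<_; _≥_)
open import Data.Nat.Divisibility using (_∣_)
open import Data.Fin using (Fin)
open import Data.Fin.Subset
  using (Subset; ⁅_⁆; _∪_; _∩_; ∁; _⊆_; _⊂_; ∣_∣) renaming (⊤ to Eₛ; ⊥ to ∅)
open import Data.List using (List; []; _∷_; _++_; length; foldr)
open import Data.List.Relation.Unary.Unique.Propositional using (Unique)
open import Data.Product using (Σ; ∃; _×_; _,_)
open import Data.Sum using (_⊎_)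
open import Data.Unit using (⊤)
open import Relation.Nullary using (¬_)
open import Relation.Binary.PropositionalEquality using (_≡_)

record Matroid (n : ℕ) : Set where
  field
    r         : Subset n → ℕ
    r-card    : ∀ X → r X ≤ ∣ X ∣
    r-mono    : ∀ X Y → X ⊆ Y → r X ≤ r Y
    r-submod  : ∀ X Y → r (X ∪ Y) + r (X ∩ Y) ≤ r X + r Y

open Matroid public

module _ {n : ℕ} (M : Matroid n) where

  r* : Subset n → ℕ
  r* X = ∣ X ∣ + r M (∁ X) ∸ r M Eₛ

  -- local connectivity ⊓(X,Y) = r(X) + r(Y) - r(X ∪ Y)   (never truncated)
  ⊓ : Subset n → Subset n → ℕ
  ⊓ X Y = r M X + r M Y ∸ r M (X ∪ Y)

  ⊓* : Subset n → Subset n → ℕ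
  ⊓* X Y = r* X + r* Y ∸ r* (X ∪ Y)

module _ {n : ℕ} (rk : Subset n → ℕ) where
  Independentᵣ : Subset n → Set
  Independentᵣ X = rk X ≡ ∣ X ∣

  Circuitᵣ : Subset n → Set
  Circuitᵣ C = ¬ Independentᵣ C × (∀ D → D ⊂ C → Independentᵣ D)

module _ {n : ℕ} (M : Matroid n) where

  Circuit : Subset n → Set
  Circuit = Circuitᵣ (r M)

  Cocircuit : Subset n → Set
  Cocircuit = Circuitᵣ (r* M)

  Triangle : Subset n → Set
  Triangle T = Circuit T × ∣ T ∣ ≡ 3

  Triad : Subset n → Set
  Triad T = Cocircuit T × ∣ T ∣ ≡ 3

  Quad : Subset n → Set
  Quad Q = Circuit Q × Cocircuit Q × ∣ Q ∣ ≡ 4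

  Separation : ℕ → Subset n → Set
  Separation k X = ∣ X ∣ ≥ k × ∣ ∁ X ∣ ≥ k × r M X + r M (∁ X) ∸ r M Eₛ < k

  ThreeConnected : Set
  ThreeConnected = ∀ k X → 1 ≤ k → k < 3 → ¬ Separation k X

listSet : ∀ {n} → List (Fin n) → Subset n
listSet = foldr (λ x S → ⁅ x ⁆ ∪ S) ∅

set3 : ∀ {n} → Fin n → Fin n → Fin n → Subset n
set3 x y z = ⁅ x ⁆ ∪ ⁅ y ⁆ ∪ ⁅ z ⁆

set4 : ∀ {n} → Fin n → Fin n → Fin n → Fin n → Subset n
set4 w x y z = ⁅ w ⁆ ∪ ⁅ x ⁆ ∪ ⁅ y ⁆ ∪ ⁅ z ⁆

module _ {n : ℕ} (M : Matroid n) where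

  AltTri   : List (Fin n) → Set
  AltTriad : List (Fin n) → Set
  AltTri (x ∷ y ∷ z ∷ rest) = Triangle M (set3 x y z) × AltTriad (y ∷ z ∷ rest)
  AltTri _ = ⊤
  AltTriad (x ∷ y ∷ z ∷ rest) = Triad M (set3 x y z) × AltTri (y ∷ z ∷ rest)
  AltTriad _ = ⊤

  FanOrdering : List (Fin n) → Set
  FanOrdering l = length l ≥ 3 × Unique l × (AltTri l ⊎ AltTriad l)

  IsFan : Subset n → Set
  IsFan S = ∣ S ∣ ≡ 2 ⊎ Σ (List (Fin n)) (λ l → FanOrdering l × S ≡ listSet l)

  MaximalFan : Subset n → Set
  MaximalFan S = IsFan S × (∀ T → IsFan T → S ⊆ T → T ≡ S)

  NotIn4Fan : Subset n → Set
  NotIn4Fan T = ∀ S → IsFan S → ∣ S ∣ ≡ 4 → ¬ (T ⊆ S)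

  Disjoint : Subset n → Subset n → Set
  Disjoint X Y = X ∩ Y ≡ ∅

  EndBase : Subset n → Subset n → Set
  EndBase F X = Disjoint X F × n ≥ ∣ X ∪ F ∣ + 2

  -- left-hand ends (e₁, e₂ the first two elements of the ordering of F)

  LeftFanEnd : Subset n → Fin n → Fin n → Subset n → Set
  LeftFanEnd F e₁ e₂ X = EndBase F X ×
    Σ (Fin n) λ g₂ → Σ (Fin n) λ g₃ → Σ (Fin n) λ g₄ → Σ (Fin n) λ g₅ →
      MaximalFan (X ∪ ⁅ e₁ ⁆) ×
      FanOrdering (e₁ ∷ g₂ ∷ g₃ ∷ g₄ ∷ g₅ ∷ []) ×
      X ∪ ⁅ e₁ ⁆ ≡ listSet (e₁ ∷ g₂ ∷ g₃ ∷ g₄ ∷ g₅ ∷ []) ×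
      Triangle M (set3 e₁ g₂ g₃) ×
      Cocircuit M (set4 e₁ e₂ g₃ g₅)

  LeftQuadEndWith : Subset n → Fin n → Fin n → Subset n →
                    Fin n → Fin n → Fin n → Fin n → Set
  LeftQuadEndWith F e₁ e₂ X a₁ a₂ b₁ b₂ = EndBase F X ×
    X ≡ set4 a₁ a₂ b₁ b₂ × Quad M X ×
    Triangle M (set3 e₁ a₁ a₂) × NotIn4Fan (set3 e₁ a₁ a₂) ×
    Triangle M (set3 e₁ b₁ b₂) × NotIn4Fan (set3 e₁ b₁ b₂) ×
    Cocircuit M (set4 e₁ e₂ a₁ b₁) × Cocircuit M (set4 e₁ e₂ a₂ b₂)

  LeftQuadEnd : Subset n → Fin n → Fin n → Subset n → Set
  LeftQuadEnd F e₁ e₂ X =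
    Σ (Fin n) λ a₁ → Σ (Fin n) λ a₂ → Σ (Fin n) λ b₁ → Σ (Fin n) λ b₂ →
      LeftQuadEndWith F e₁ e₂ X a₁ a₂ b₁ b₂

  LeftTriangleEnd : Subset n → Fin n → Fin n → Subset n → Set
  LeftTriangleEnd F e₁ e₂ X = EndBase F X ×
    Triangle M (X ∪ ⁅ e₁ ⁆) × NotIn4Fan (X ∪ ⁅ e₁ ⁆) ×
    Cocircuit M (X ∪ ⁅ e₁ ⁆ ∪ ⁅ e₂ ⁆)

  -- right-hand ends (f' = e_{|F|-1}, f = e_{|F|})

  RightFanEnd : Subset n → Fin n → Fin n → Subset n → Set
  RightFanEnd F f' f X = EndBase F X ×
    Σ (Fin n) λ h₂ → Σ (Fin n) λ h₃ → Σ (Fin n) λ h₄ → Σ (Fin n) λ h₅ →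
      MaximalFan (X ∪ ⁅ f ⁆) ×
      FanOrdering (f ∷ h₂ ∷ h₃ ∷ h₄ ∷ h₅ ∷ []) ×
      X ∪ ⁅ f ⁆ ≡ listSet (f ∷ h₂ ∷ h₃ ∷ h₄ ∷ h₅ ∷ []) ×
      Triad M (set3 f h₂ h₃) ×
      Circuit M (set4 f' f h₃ h₅)

  RightQuadEnd : Subset n → Fin n → Fin n → Subset n → Set
  RightQuadEnd F f' f X = EndBase F X ×
    Σ (Fin n) λ c₁ → Σ (Fin n) λ c₂ → Σ (Fin n) λ d₁ → Σ (Fin n) λ d₂ →
      X ≡ set4 c₁ c₂ d₁ d₂ × Quad M X ×
      Triad M (set3 f c₁ c₂) × NotIn4Fan (set3 f c₁ c₂) ×
      Triad M (set3 f d₁ d₂) × NotIn4Fan (set3 f d₁ d₂) ×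
      Circuit M (set4 f' f c₁ d₁) × Circuit M (set4 f' f c₂ d₂)

  RightTriadEnd : Subset n → Fin n → Fin n → Subset n → Set
  RightTriadEnd F f' f X = EndBase F X ×
    Triad M (X ∪ ⁅ f ⁆) × NotIn4Fan (X ∪ ⁅ f ⁆) ×
    Circuit M (X ∪ ⁅ f' ⁆ ∪ ⁅ f ⁆)

  fanList : Fin n → Fin n → List (Fin n) → Fin n → Fin n → List (Fin n)
  fanList e₁ e₂ mid f' f = e₁ ∷ e₂ ∷ (mid ++ f' ∷ f ∷ [])

  AccordionWith : Subset n → Subset n → Subset n →
                  Fin n → Fin n → List (Fin n) → Fin n → Fin n → Set
  AccordionWith G F H e₁ e₂ mid f' f =
    Disjoint G F × Disjoint G H × Disjoint F H × G ∪ F ∪ H ≡ Eₛ ×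
    MaximalFan F ×
    FanOrdering (fanList e₁ e₂ mid f' f) ×
    F ≡ listSet (fanList e₁ e₂ mid f' f) ×
    AltTri (fanList e₁ e₂ mid f' f) ×
    length (fanList e₁ e₂ mid f' f) ≥ 4 ×
    2 ∣ length (fanList e₁ e₂ mid f' f) ×
    (LeftFanEnd F e₁ e₂ G ⊎ LeftQuadEnd F e₁ e₂ G ⊎ LeftTriangleEnd F e₁ e₂ G) ×
    (RightFanEnd F f' f H ⊎ RightQuadEnd F f' f H ⊎ RightTriadEnd F f' f H)

{-# OPTIONS --safe #-}

-- Let X be one of the pairs. As X is a proper subset of the quad G, r(X) = 2 (and r*(X) = 2), so
-- it suffices to show r(X ∪ H) = r(H) + 1. A cocircuit through an element of X avoiding H gives ≥.
-- For ≤, start from Z = F ∪ H = E - G: since G is a cocircuit, r(X ∪ Z) ≤ r(M) ≤ r(Z) + 1. Then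
-- delete e₁, e₂, …, e_|F| from Z one at a time. Each is either spanned by the rest of Z (by the
-- triangle it starts, or by the right-hand end for the last such element) or lies outside the
-- closure of X together with the rest of Z (by the triad it ends, or the quad-end cocircuit for
-- e₂), and neither kind of deletion increases r(X ∪ Z) - r(Z).
-- Part (ii) is the same argument in the dual matroid, in which G is still a quad, the triangles at
-- e₁ are cocircuits and F is a fan starting with a triad.
module Submission where

open import Defs
import Algebra.Lattice.Properties.BooleanAlgebra as BooleanAlgebraProperties
import Algebra.Properties.CommutativeSemigroup as CommutativeSemigroupProperties
open import Algebra.Bundles using (CommutativeMonoid)
open import Data.Fin using (Fin)
open import Data.Fin.Subset
  using (Subset; ⁅_⁆; _∪_; _∩_; ∁; _⊆_; _⊂_; _∈_; _∉_; ∣_∣; inside; outside)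
  renaming (⊤ to Eₛ; ⊥ to ∅)
open import Data.Fin.Subset.Properties
open import Data.List using (List; []; _∷_; _++_; length)
open import Data.List.Relation.Unary.All using (All; []; _∷_)
import Data.List.Relation.Unary.All as All
open import Data.List.Relation.Unary.AllPairs using (_∷_)
import Data.List.Relation.Unary.AllPairs as AllPairs
open import Data.List.Relation.Unary.Unique.Propositional using (Unique)
open import Data.Nat using (ℕ; suc; _+_; _∸_; _≤_; _<_; s≤s)
open import Data.Nat.Divisibility using (_∣_; ∣m+n∣m⇒∣n; ∣-refl; ∣1⇒≡1)
open import Data.Nat.Properties
open import Data.Product using (_×_; _,_; proj₁; proj₂)
open import Data.Sum using (_⊎_; inj₁; inj₂; [_,_]′)
open import Data.Unit using (⊤; tt)
open import Data.Vec.Base using ([]; _∷_)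
open import Function using (_∘_; id)
open import Relation.Nullary using (¬_; yes; no; contradiction)
open import Relation.Binary.PropositionalEquality
  using (_≡_; _≢_; refl; sym; trans; cong; cong₂; subst; module ≡-Reasoning)

open CommutativeSemigroupProperties +-commutativeSemigroup
  using () renaming (interchange to +-interchange; xy∙z≈xz∙y to +-right-comm)

module _ {n : ℕ} where
  open CommutativeSemigroupProperties
         (CommutativeMonoid.commutativeSemigroup (∪-commutativeMonoid n)) public
    using () renaming (interchange to ∪-interchange; x∙yz≈y∙xz to ∪-left-comm)
  open BooleanAlgebraProperties (∪-∩-booleanAlgebra n) public
    using (deMorgan₁; deMorgan₂) renaming (¬-involutive to ∁-involutive; ¬⊤≈⊥ to ∁⊤≡∅)

module _ {n : ℕ} {p q : Subset n} where

  ∪-introˡ : ∀ {x} → x ∈ p → x ∈ p ∪ q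
  ∪-introˡ x∈p = x∈p∪q⁺ (inj₁ x∈p)

  ∪-introʳ : ∀ {x} → x ∈ q → x ∈ p ∪ q
  ∪-introʳ x∈q = x∈p∪q⁺ (inj₂ x∈q)

  ∪-⊆ : ∀ {s} → p ⊆ s → q ⊆ s → p ∪ q ⊆ s
  ∪-⊆ p⊆s q⊆s x∈p∪q = [ p⊆s , q⊆s ]′ (x∈p∪q⁻ p q x∈p∪q)

  ∩≡∅⇒∉ : p ∩ q ≡ ∅ → ∀ {x} → x ∈ p → x ∉ q
  ∩≡∅⇒∉ p∩q≡∅ {x} x∈p x∈q = ∉⊥ (subst (x ∈_) p∩q≡∅ (x∈p∩q⁺ (x∈p , x∈q)))

⁅⁆-⊆ : ∀ {n} {x : Fin n} {s} → x ∈ s → ⁅ x ⁆ ⊆ s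
⁅⁆-⊆ {x = x} {s} x∈s y∈⁅x⁆ = subst (_∈ s) (sym (x∈⁅y⁆⇒x≡y x y∈⁅x⁆)) x∈s

⊆-∪-split : ∀ {n} (p q : Subset n) → p ⊆ q ∪ (p ∩ ∁ q)
⊆-∪-split p q {x} x∈p with x ∈? q
... | yes x∈q = ∪-introˡ x∈q
... | no  x∉q = ∪-introʳ (x∈p∩q⁺ (x∈p , x∉p⇒x∈∁p x∉q))

∩∁⁅⁆⊂ : ∀ {n} {x : Fin n} {p} → x ∈ p → p ∩ ∁ ⁅ x ⁆ ⊂ p
∩∁⁅⁆⊂ {x = x} {p} x∈p =
  p∩q⊆p p _ , x , x∈p , λ x∈ → x∈∁p⇒x∉p (proj₂ (x∈p∩q⁻ p _ x∈)) (x∈⁅x⁆ x)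

∣p∪q∣+∣p∩q∣≡∣p∣+∣q∣ : ∀ {n} (p q : Subset n) → ∣ p ∪ q ∣ + ∣ p ∩ q ∣ ≡ ∣ p ∣ + ∣ q ∣
∣p∪q∣+∣p∩q∣≡∣p∣+∣q∣ []            []            = refl
∣p∪q∣+∣p∩q∣≡∣p∣+∣q∣ (outside ∷ p) (outside ∷ q) = ∣p∪q∣+∣p∩q∣≡∣p∣+∣q∣ p q
∣p∪q∣+∣p∩q∣≡∣p∣+∣q∣ (outside ∷ p) (inside  ∷ q) =
  trans (cong suc (∣p∪q∣+∣p∩q∣≡∣p∣+∣q∣ p q)) (sym (+-suc ∣ p ∣ ∣ q ∣))
∣p∪q∣+∣p∩q∣≡∣p∣+∣q∣ (inside  ∷ p) (outside ∷ q) = cong suc (∣p∪q∣+∣p∩q∣≡∣p∣+∣q∣ p q)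
∣p∪q∣+∣p∩q∣≡∣p∣+∣q∣ (inside  ∷ p) (inside  ∷ q) = cong suc (begin
  ∣ p ∪ q ∣ + suc ∣ p ∩ q ∣   ≡⟨ +-suc ∣ p ∪ q ∣ ∣ p ∩ q ∣ ⟩
  suc (∣ p ∪ q ∣ + ∣ p ∩ q ∣) ≡⟨ cong suc (∣p∪q∣+∣p∩q∣≡∣p∣+∣q∣ p q) ⟩
  suc (∣ p ∣ + ∣ q ∣)         ≡⟨ +-suc ∣ p ∣ ∣ q ∣ ⟨
  ∣ p ∣ + suc ∣ q ∣           ∎)
  where open ≡-Reasoning

∣p∪q∣≤∣p∣+∣q∣ : ∀ {n} (p q : Subset n) → ∣ p ∪ q ∣ ≤ ∣ p ∣ + ∣ q ∣
∣p∪q∣≤∣p∣+∣q∣ p q = subst (∣ p ∪ q ∣ ≤_) (∣p∪q∣+∣p∩q∣≡∣p∣+∣q∣ p q) (m≤m+n _ _)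

∣p∣+∣∁p∣≡n : ∀ {n} (p : Subset n) → ∣ p ∣ + ∣ ∁ p ∣ ≡ n
∣p∣+∣∁p∣≡n p = trans (cong (∣ p ∣ +_) (∣∁p∣≡n∸∣p∣ p)) (m+[n∸m]≡n (∣p∣≤n p))

∣p∣+∣q∩∁p∣≤∣q∣ : ∀ {n} {p q : Subset n} → p ⊆ q → ∣ p ∣ + ∣ q ∩ ∁ p ∣ ≤ ∣ q ∣
∣p∣+∣q∩∁p∣≤∣q∣ {n} {p} {q} p⊆q = begin
  ∣ p ∣ + ∣ q ∩ ∁ p ∣                              ≡⟨ ∣p∪q∣+∣p∩q∣≡∣p∣+∣q∣ p (q ∩ ∁ p) ⟨
  ∣ p ∪ (q ∩ ∁ p) ∣ + ∣ p ∩ (q ∩ ∁ p) ∣            ≡⟨ cong (λ s → ∣ p ∪ (q ∩ ∁ p) ∣ + ∣ s ∣) no-overlap ⟩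
  ∣ p ∪ (q ∩ ∁ p) ∣ + ∣ ∅ {n} ∣                    ≡⟨ cong (∣ p ∪ (q ∩ ∁ p) ∣ +_) (∣⊥∣≡0 n) ⟩
  ∣ p ∪ (q ∩ ∁ p) ∣ + 0                            ≡⟨ +-identityʳ _ ⟩
  ∣ p ∪ (q ∩ ∁ p) ∣                                ≤⟨ p⊆q⇒∣p∣≤∣q∣ (∪-⊆ p⊆q (p∩q⊆p q (∁ p))) ⟩
  ∣ q ∣                                            ∎
  where
  open ≤-Reasoning
  no-overlap : p ∩ (q ∩ ∁ p) ≡ ∅
  no-overlap = Empty-unique λ (x , x∈) →
    let (x∈p , x∈q∩∁p) = x∈p∩q⁻ p _ x∈ in x∈∁p⇒x∉p (proj₂ (x∈p∩q⁻ q _ x∈q∩∁p)) x∈p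

∣⁅x⁆∪⁅y⁆∣≤2 : ∀ {n} (x y : Fin n) → ∣ ⁅ x ⁆ ∪ ⁅ y ⁆ ∣ ≤ 2
∣⁅x⁆∪⁅y⁆∣≤2 x y =
  subst (∣ ⁅ x ⁆ ∪ ⁅ y ⁆ ∣ ≤_) (cong₂ _+_ (∣⁅x⁆∣≡1 x) (∣⁅x⁆∣≡1 y)) (∣p∪q∣≤∣p∣+∣q∣ ⁅ x ⁆ ⁅ y ⁆)

set3-⊆ : ∀ {n} {a b c : Fin n} {s} → a ∈ s → b ∈ s → c ∈ s → set3 a b c ⊆ s
set3-⊆ a∈s b∈s c∈s = ∪-⊆ (⁅⁆-⊆ a∈s) (∪-⊆ (⁅⁆-⊆ b∈s) (⁅⁆-⊆ c∈s))

set4-⊆ : ∀ {n} {a b c d : Fin n} {s} → a ∈ s → b ∈ s → c ∈ s → d ∈ s → set4 a b c d ⊆ s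
set4-⊆ a∈s b∈s c∈s d∈s = ∪-⊆ (⁅⁆-⊆ a∈s) (set3-⊆ b∈s c∈s d∈s)

x∈p⇒1≤∣p∣ : ∀ {n} {x : Fin n} {p} → x ∈ p → 1 ≤ ∣ p ∣
x∈p⇒1≤∣p∣ {x = x} x∈p = subst (_≤ _) (∣⁅x⁆∣≡1 x) (p⊆q⇒∣p∣≤∣q∣ (⁅⁆-⊆ x∈p))

∣p∪q∣≡4⇒disjoint-pairs : ∀ {n} (p q : Subset n) → ∣ p ∣ ≤ 2 → ∣ q ∣ ≤ 2 → ∣ p ∪ q ∣ ≡ 4 →
                         ∣ p ∣ ≡ 2 × (∀ {x} → x ∈ q → x ∉ p)
∣p∪q∣≡4⇒disjoint-pairs p q ∣p∣≤2 ∣q∣≤2 ∣p∪q∣≡4 = ≤-antisym ∣p∣≤2 2≤∣p∣ , x∈q⇒x∉p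
  where
  open ≤-Reasoning
  4+∣p∩q∣≡∣p∣+∣q∣ : 4 + ∣ p ∩ q ∣ ≡ ∣ p ∣ + ∣ q ∣
  4+∣p∩q∣≡∣p∣+∣q∣ = trans (cong (_+ ∣ p ∩ q ∣) (sym ∣p∪q∣≡4)) (∣p∪q∣+∣p∩q∣≡∣p∣+∣q∣ p q)
  2≤∣p∣ : 2 ≤ ∣ p ∣
  2≤∣p∣ = +-cancelʳ-≤ 2 2 ∣ p ∣ (begin
    4             ≤⟨ m≤m+n 4 _ ⟩
    4 + ∣ p ∩ q ∣ ≡⟨ 4+∣p∩q∣≡∣p∣+∣q∣ ⟩
    ∣ p ∣ + ∣ q ∣ ≤⟨ +-monoʳ-≤ ∣ p ∣ ∣q∣≤2 ⟩
    ∣ p ∣ + 2     ∎)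
  x∈q⇒x∉p : ∀ {x} → x ∈ q → x ∉ p
  x∈q⇒x∉p x∈q x∈p = <⇒≱ (begin-strict
    ∣ p ∣ + ∣ q ∣ ≤⟨ +-mono-≤ ∣p∣≤2 ∣q∣≤2 ⟩
    4             <⟨ +-monoʳ-≤ 4 (x∈p⇒1≤∣p∣ (x∈p∩q⁺ (x∈p , x∈q))) ⟩
    4 + ∣ p ∩ q ∣ ∎) (≤-reflexive 4+∣p∩q∣≡∣p∣+∣q∣)

All≢⇒∉listSet : ∀ {n} {x : Fin n} {l} → All (x ≢_) l → x ∉ listSet l
All≢⇒∉listSet []                  = ∉⊥
All≢⇒∉listSet {l = y ∷ l} (x≢y ∷ x∉l) x∈ =
  [ x≢y ∘ x∈⁅y⁆⇒x≡y y , All≢⇒∉listSet x∉l ]′ (x∈p∪q⁻ ⁅ y ⁆ (listSet l) x∈)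

listSet⇒All : ∀ {n} {P : Fin n → Set} l → (∀ {x} → x ∈ listSet l → P x) → All P l
listSet⇒All []      _ = []
listSet⇒All (x ∷ l) h = h (∪-introˡ (x∈⁅x⁆ x)) ∷ listSet⇒All l (h ∘ ∪-introʳ)

∉-∪-listSet : ∀ {n} {X H : Subset n} {x l} → x ∉ X ∪ H → All (x ≢_) l → x ∉ X ∪ (listSet l ∪ H)
∉-∪-listSet {X = X} {H} {l = l} x∉X∪H x∉l x∈ with x∈p∪q⁻ X _ x∈
... | inj₁ x∈X   = x∉X∪H (∪-introˡ x∈X)
... | inj₂ x∈L∪H = [ All≢⇒∉listSet x∉l , x∉X∪H ∘ ∪-introʳ ]′ (x∈p∪q⁻ (listSet l) H x∈L∪H)

2∣2+n⇒2∣n : ∀ {m} → 2 ∣ 2 + m → 2 ∣ m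
2∣2+n⇒2∣n 2∣2+m = ∣m+n∣m⇒∣n 2∣2+m ∣-refl

2∤1 : ¬ 2 ∣ 1
2∤1 2∣1 with ∣1⇒≡1 2∣1
... | ()

-- Rank, closure, circuits and cocircuits

module _ {n : ℕ} (N : Matroid n) where

  InClosure : Subset n → Fin n → Set
  InClosure A e = r N (⁅ e ⁆ ∪ A) ≤ r N A

  OutsideClosure : Subset n → Fin n → Set
  OutsideClosure A e = r N A < r N (⁅ e ⁆ ∪ A)

  r-∪≤∣∣+r : ∀ A B → r N (A ∪ B) ≤ ∣ A ∣ + r N B
  r-∪≤∣∣+r A B = ≤-trans (m≤m+n _ _) (≤-trans (r-submod N A B) (+-monoˡ-≤ (r N B) (r-card N A)))

  r-⁅⁆∪≤ : ∀ A e → r N (⁅ e ⁆ ∪ A) ≤ suc (r N A)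
  r-⁅⁆∪≤ A e = subst (λ k → r N (⁅ e ⁆ ∪ A) ≤ k + r N A) (∣⁅x⁆∣≡1 e) (r-∪≤∣∣+r ⁅ e ⁆ A)

  rE≤∣∣+r∁ : ∀ A → r N Eₛ ≤ ∣ A ∣ + r N (∁ A)
  rE≤∣∣+r∁ A = subst (λ S → r N S ≤ ∣ A ∣ + r N (∁ A)) (p∪∁p≡⊤ A) (r-∪≤∣∣+r A (∁ A))

  r*+rE : ∀ A → r* N A + r N Eₛ ≡ ∣ A ∣ + r N (∁ A)
  r*+rE A = m∸n+n≡m (rE≤∣∣+r∁ A)

  circuit-rank≤ : ∀ {C e} → Circuit N C → e ∈ C → r N C ≤ r N (C ∩ ∁ ⁅ e ⁆)
  circuit-rank≤ {C} {e} (dependent , minimal) e∈C = ≤-pred (begin-strict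
    r N C                      <⟨ ≤∧≢⇒< (r-card N C) dependent ⟩
    ∣ C ∣                      ≤⟨ p⊆q⇒∣p∣≤∣q∣ (⊆-∪-split C ⁅ e ⁆) ⟩
    ∣ ⁅ e ⁆ ∪ C ∩ ∁ ⁅ e ⁆ ∣     ≤⟨ ∣p∪q∣≤∣p∣+∣q∣ ⁅ e ⁆ _ ⟩
    ∣ ⁅ e ⁆ ∣ + ∣ C ∩ ∁ ⁅ e ⁆ ∣ ≡⟨ cong₂ _+_ (∣⁅x⁆∣≡1 e) (sym (minimal _ (∩∁⁅⁆⊂ e∈C))) ⟩
    suc (r N (C ∩ ∁ ⁅ e ⁆))    ∎)
    where open ≤-Reasoning

  circuit⇒InClosure : ∀ {C A e} → Circuit N C → e ∈ C → C ⊆ ⁅ e ⁆ ∪ A → InClosure A e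
  circuit⇒InClosure {C} {A} {e} circuit e∈C C⊆ = +-cancelʳ-≤ (r N D) _ _ (begin
    r N (⁅ e ⁆ ∪ A) + r N D ≤⟨ +-mono-≤ (r-mono N _ _ (∪-⊆ (⁅⁆-⊆ (∪-introˡ e∈C)) ∪-introʳ))
                                         (r-mono N _ _ D⊆C∩A) ⟩
    r N (C ∪ A) + r N (C ∩ A) ≤⟨ r-submod N C A ⟩
    r N C + r N A           ≤⟨ +-monoˡ-≤ (r N A) (circuit-rank≤ circuit e∈C) ⟩
    r N D + r N A           ≡⟨ +-comm (r N D) (r N A) ⟩
    r N A + r N D           ∎)
    where
    open ≤-Reasoning
    D : Subset n
    D = C ∩ ∁ ⁅ e ⁆
    D⊆C∩A : D ⊆ C ∩ A
    D⊆C∩A x∈D with x∈p∩q⁻ C _ x∈D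
    ... | x∈C , x∉⁅e⁆ = x∈p∩q⁺ (x∈C ,
      [ (λ x∈⁅e⁆ → contradiction x∈⁅e⁆ (x∈∁p⇒x∉p x∉⁅e⁆)) , id ]′ (x∈p∪q⁻ ⁅ e ⁆ A (C⊆ x∈C)))

  coindependent⇒spanning : ∀ {D} → r* N D ≡ ∣ D ∣ → r N Eₛ ≤ r N (∁ D)
  coindependent⇒spanning {D} r*D≡∣D∣ = ≤-reflexive (+-cancelˡ-≡ ∣ D ∣ _ _
    (trans (cong (_+ r N Eₛ) (sym r*D≡∣D∣)) (r*+rE D)))

  codependent⇒r∁<rE : ∀ {D} → ¬ r* N D ≡ ∣ D ∣ → r N (∁ D) < r N Eₛ
  codependent⇒r∁<rE {D} dependent = ≰⇒> λ rE≤r∁D → dependent (+-cancelʳ-≡ (r N Eₛ) _ _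
    (trans (r*+rE D) (cong (∣ D ∣ +_) (≤-antisym (r-mono N _ _ ⊆⊤) rE≤r∁D))))

  cocircuit-spanning : ∀ {C e} → Cocircuit N C → e ∈ C → r N Eₛ ≤ r N (⁅ e ⁆ ∪ ∁ C)
  cocircuit-spanning {C} {e} (_ , minimal) e∈C =
    ≤-trans (coindependent⇒spanning (minimal _ (∩∁⁅⁆⊂ e∈C))) (r-mono N _ _ ∁[C∖e]⊆)
    where
    ∁[C∖e]⊆ : ∁ (C ∩ ∁ ⁅ e ⁆) ⊆ ⁅ e ⁆ ∪ ∁ C
    ∁[C∖e]⊆ rewrite deMorgan₁ C (∁ ⁅ e ⁆) | ∁-involutive ⁅ e ⁆ = ⊆-reflexive (∪-comm (∁ C) ⁅ e ⁆)

  cocircuit-complement : ∀ {C e} → Cocircuit N C → e ∈ C → r N Eₛ ≤ suc (r N (∁ C))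
  cocircuit-complement {C} {e} cocircuit e∈C =
    ≤-trans (cocircuit-spanning cocircuit e∈C) (r-⁅⁆∪≤ (∁ C) e)

  cocircuit⇒OutsideClosure : ∀ {C A e} → Cocircuit N C → e ∈ C → C ⊆ ∁ A → OutsideClosure A e
  cocircuit⇒OutsideClosure {C} {A} {e} cocircuit e∈C C⊆∁A = +-cancelʳ-≤ (r N (∁ C)) _ _ (begin
    suc (r N A) + r N (∁ C)      ≡⟨ +-suc (r N A) (r N (∁ C)) ⟨
    r N A + suc (r N (∁ C))      ≤⟨ +-monoʳ-≤ (r N A) (codependent⇒r∁<rE (proj₁ cocircuit)) ⟩
    r N A + r N Eₛ               ≡⟨ +-comm (r N A) (r N Eₛ) ⟩
    r N Eₛ + r N A               ≤⟨ +-mono-≤ (≤-trans (cocircuit-spanning cocircuit e∈C)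
                                               (r-mono N _ _ (∪-⊆ (∪-introˡ ∘ ∪-introˡ) ∪-introʳ)))
                                             (r-mono N _ _ A⊆) ⟩
    r N (S ∪ ∁ C) + r N (S ∩ ∁ C) ≤⟨ r-submod N S (∁ C) ⟩
    r N S + r N (∁ C)            ∎)
    where
    open ≤-Reasoning
    S : Subset n
    S = ⁅ e ⁆ ∪ A
    A⊆ : A ⊆ S ∩ ∁ C
    A⊆ x∈A = x∈p∩q⁺ (∪-introʳ x∈A , x∉p⇒x∈∁p (λ x∈C → x∈∁p⇒x∉p (C⊆∁A x∈C) x∈A))

-- The dual matroid

circuitᵣ-resp : ∀ {n} {rk rk′ : Subset n → ℕ} → (∀ X → rk X ≡ rk′ X) →
                ∀ {C} → Circuitᵣ rk C → Circuitᵣ rk′ C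
circuitᵣ-resp rk≡rk′ {C} (dependent , minimal) =
  (λ independent → dependent (trans (rk≡rk′ C) independent)) ,
  (λ D D⊂C → trans (sym (rk≡rk′ D)) (minimal D D⊂C))

module _ {n : ℕ} (M : Matroid n) where

  private
    R : ℕ
    R = r M Eₛ

  r*-card : ∀ X → r* M X ≤ ∣ X ∣
  r*-card X = +-cancelʳ-≤ R _ _ (begin
    r* M X + R          ≡⟨ r*+rE M X ⟩
    ∣ X ∣ + r M (∁ X)   ≤⟨ +-monoʳ-≤ ∣ X ∣ (r-mono M _ _ ⊆⊤) ⟩
    ∣ X ∣ + R           ∎)
    where open ≤-Reasoning

  r*-mono : ∀ X Y → X ⊆ Y → r* M X ≤ r* M Y
  r*-mono X Y X⊆Y = +-cancelʳ-≤ R _ _ (begin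
    r* M X + R                          ≡⟨ r*+rE M X ⟩
    ∣ X ∣ + r M (∁ X)                   ≤⟨ +-monoʳ-≤ ∣ X ∣ r∁X≤ ⟩
    ∣ X ∣ + (∣ Y ∩ ∁ X ∣ + r M (∁ Y))   ≡⟨ +-assoc ∣ X ∣ _ _ ⟨
    ∣ X ∣ + ∣ Y ∩ ∁ X ∣ + r M (∁ Y)     ≤⟨ +-monoˡ-≤ (r M (∁ Y)) (∣p∣+∣q∩∁p∣≤∣q∣ X⊆Y) ⟩
    ∣ Y ∣ + r M (∁ Y)                   ≡⟨ r*+rE M Y ⟨
    r* M Y + R                          ∎)
    where
    open ≤-Reasoning
    ∁X⊆ : ∁ X ⊆ (Y ∩ ∁ X) ∪ ∁ Y
    ∁X⊆ {z} z∈∁X with z ∈? Y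
    ... | yes z∈Y = ∪-introˡ (x∈p∩q⁺ (z∈Y , z∈∁X))
    ... | no  z∉Y = ∪-introʳ (x∉p⇒x∈∁p z∉Y)
    r∁X≤ : r M (∁ X) ≤ ∣ Y ∩ ∁ X ∣ + r M (∁ Y)
    r∁X≤ = ≤-trans (r-mono M _ _ ∁X⊆) (r-∪≤∣∣+r M (Y ∩ ∁ X) (∁ Y))

  r*-submod : ∀ X Y → r* M (X ∪ Y) + r* M (X ∩ Y) ≤ r* M X + r* M Y
  r*-submod X Y = +-cancelʳ-≤ (R + R) _ _ (begin
    (r* M (X ∪ Y) + r* M (X ∩ Y)) + (R + R)
      ≡⟨ +-interchange (r* M (X ∪ Y)) (r* M (X ∩ Y)) R R ⟩
    (r* M (X ∪ Y) + R) + (r* M (X ∩ Y) + R)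
      ≡⟨ cong₂ _+_ (r*+rE M (X ∪ Y)) (r*+rE M (X ∩ Y)) ⟩
    (∣ X ∪ Y ∣ + r M (∁ (X ∪ Y))) + (∣ X ∩ Y ∣ + r M (∁ (X ∩ Y)))
      ≡⟨ +-interchange (∣ X ∪ Y ∣) (r M (∁ (X ∪ Y))) (∣ X ∩ Y ∣) (r M (∁ (X ∩ Y))) ⟩
    (∣ X ∪ Y ∣ + ∣ X ∩ Y ∣) + (r M (∁ (X ∪ Y)) + r M (∁ (X ∩ Y)))
      ≤⟨ +-mono-≤ (≤-reflexive (∣p∪q∣+∣p∩q∣≡∣p∣+∣q∣ X Y)) complements ⟩
    (∣ X ∣ + ∣ Y ∣) + (r M (∁ X) + r M (∁ Y))
      ≡⟨ +-interchange (∣ X ∣) (∣ Y ∣) (r M (∁ X)) (r M (∁ Y)) ⟩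
    (∣ X ∣ + r M (∁ X)) + (∣ Y ∣ + r M (∁ Y))
      ≡⟨ cong₂ _+_ (r*+rE M X) (r*+rE M Y) ⟨
    (r* M X + R) + (r* M Y + R)
      ≡⟨ +-interchange (r* M X) R (r* M Y) R ⟩
    (r* M X + r* M Y) + (R + R)
      ∎)
    where
    open ≤-Reasoning
    complements : r M (∁ (X ∪ Y)) + r M (∁ (X ∩ Y)) ≤ r M (∁ X) + r M (∁ Y)
    complements rewrite deMorgan₂ X Y | deMorgan₁ X Y =
      subst (_≤ r M (∁ X) + r M (∁ Y)) (+-comm (r M (∁ X ∪ ∁ Y)) _) (r-submod M (∁ X) (∁ Y))

  dual : Matroid n
  dual = record { r = r* M ; r-card = r*-card ; r-mono = r*-mono ; r-submod = r*-submod }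

  r*-dual≡r : ∀ X → r* dual X ≡ r M X
  r*-dual≡r X = begin
    ∣ X ∣ + r* M (∁ X) ∸ r* M Eₛ ≡⟨ cong (_∸ r* M Eₛ) (+-cancelʳ-≡ R _ _ sums) ⟩
    r* M Eₛ + r M X ∸ r* M Eₛ    ≡⟨ m+n∸m≡n (r* M Eₛ) (r M X) ⟩
    r M X                        ∎
    where
    open ≡-Reasoning
    r∅≡0 : r M ∅ ≡ 0
    r∅≡0 = n≤0⇒n≡0 (subst (r M ∅ ≤_) (∣⊥∣≡0 n) (r-card M ∅))
    r*E+R≡n : r* M Eₛ + R ≡ n
    r*E+R≡n = begin
      r* M Eₛ + R             ≡⟨ r*+rE M Eₛ ⟩
      ∣ Eₛ {n} ∣ + r M (∁ Eₛ) ≡⟨ cong₂ _+_ (∣⊤∣≡n n) (trans (cong (r M) ∁⊤≡∅) r∅≡0) ⟩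
      n + 0                   ≡⟨ +-identityʳ n ⟩
      n                       ∎
    sums : ∣ X ∣ + r* M (∁ X) + R ≡ r* M Eₛ + r M X + R
    sums = begin
      ∣ X ∣ + r* M (∁ X) + R         ≡⟨ +-assoc ∣ X ∣ _ R ⟩
      ∣ X ∣ + (r* M (∁ X) + R)       ≡⟨ cong (∣ X ∣ +_) (r*+rE M (∁ X)) ⟩
      ∣ X ∣ + (∣ ∁ X ∣ + r M (∁ (∁ X))) ≡⟨ cong (λ S → ∣ X ∣ + (∣ ∁ X ∣ + r M S)) (∁-involutive X) ⟩
      ∣ X ∣ + (∣ ∁ X ∣ + r M X)      ≡⟨ +-assoc ∣ X ∣ _ _ ⟨
      ∣ X ∣ + ∣ ∁ X ∣ + r M X        ≡⟨ cong (_+ r M X) (trans (∣p∣+∣∁p∣≡n X) (sym r*E+R≡n)) ⟩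
      r* M Eₛ + R + r M X            ≡⟨ +-right-comm (r* M Eₛ) R (r M X) ⟩
      r* M Eₛ + r M X + R            ∎

  circuit⇒dual-cocircuit : ∀ {C} → Circuit M C → Cocircuit dual C
  circuit⇒dual-cocircuit = circuitᵣ-resp (λ X → sym (r*-dual≡r X))

  altTri⇒dual-altTriad : ∀ l → AltTri M l → AltTriad dual l
  altTriad⇒dual-altTri : ∀ l → AltTriad M l → AltTri dual l

  altTri⇒dual-altTriad []              _                         = tt
  altTri⇒dual-altTriad (_ ∷ [])        _                         = tt
  altTri⇒dual-altTriad (_ ∷ _ ∷ [])    _                         = tt
  altTri⇒dual-altTriad (_ ∷ y ∷ z ∷ l) ((circuit , ∣T∣≡3) , alt) =
    (circuit⇒dual-cocircuit circuit , ∣T∣≡3) , altTriad⇒dual-altTri (y ∷ z ∷ l) alt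

  altTriad⇒dual-altTri []              _           = tt
  altTriad⇒dual-altTri (_ ∷ [])        _           = tt
  altTriad⇒dual-altTri (_ ∷ _ ∷ [])    _           = tt
  altTriad⇒dual-altTri (_ ∷ y ∷ z ∷ l) (triad , alt) = triad , altTri⇒dual-altTriad (y ∷ z ∷ l) alt

-- Peeling

module _ {n : ℕ} (N : Matroid n) (X H : Subset n) where

  -- ⊓(X, Z) ≥ r(X) - k
  Excess≤ : ℕ → Subset n → Set
  Excess≤ k Z = r N (X ∪ Z) ≤ k + r N Z

  excess-spanned : ∀ {Z e} k → InClosure N Z e → Excess≤ k (⁅ e ⁆ ∪ Z) → Excess≤ k Z
  excess-spanned {Z} {e} k e∈clZ excess = begin
    r N (X ∪ Z)           ≤⟨ r-mono N _ _ (q⊆p∪q ⁅ e ⁆ (X ∪ Z)) ⟩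
    r N (⁅ e ⁆ ∪ (X ∪ Z)) ≡⟨ cong (r N) (∪-left-comm ⁅ e ⁆ X Z) ⟩
    r N (X ∪ (⁅ e ⁆ ∪ Z)) ≤⟨ excess ⟩
    k + r N (⁅ e ⁆ ∪ Z)   ≤⟨ +-monoʳ-≤ k e∈clZ ⟩
    k + r N Z             ∎
    where open ≤-Reasoning

  excess-free : ∀ {Z e} k → OutsideClosure N (X ∪ Z) e → Excess≤ k (⁅ e ⁆ ∪ Z) → Excess≤ k Z
  excess-free {Z} {e} k e∉clX∪Z excess = ≤-pred (begin-strict
    r N (X ∪ Z)           <⟨ e∉clX∪Z ⟩
    r N (⁅ e ⁆ ∪ (X ∪ Z)) ≡⟨ cong (r N) (∪-left-comm ⁅ e ⁆ X Z) ⟩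
    r N (X ∪ (⁅ e ⁆ ∪ Z)) ≤⟨ excess ⟩
    k + r N (⁅ e ⁆ ∪ Z)   ≤⟨ +-monoʳ-≤ k (r-⁅⁆∪≤ N Z e) ⟩
    k + suc (r N Z)       ≡⟨ +-suc k (r N Z) ⟩
    suc (k + r N Z)       ∎)
    where open ≤-Reasoning

  data Peelable : List (Fin n) → Set where
    []      : Peelable []
    spanned : ∀ {e l} → InClosure N (listSet l ∪ H) e → Peelable l → Peelable (e ∷ l)
    free    : ∀ {e l} → OutsideClosure N (X ∪ (listSet l ∪ H)) e → Peelable l → Peelable (e ∷ l)

  peel-excess : ∀ {l} k → Peelable l → Excess≤ k (listSet l ∪ H) → Excess≤ k H
  peel-excess k [] = subst (Excess≤ k) (∪-identityˡ H)
  peel-excess {e ∷ l} k (spanned e∈cl peelable) excess = peel-excess k peelable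
    (excess-spanned k e∈cl (subst (Excess≤ k) (∪-assoc ⁅ e ⁆ (listSet l) H) excess))
  peel-excess {e ∷ l} k (free e∉cl peelable) excess = peel-excess k peelable
    (excess-free k e∉cl (subst (Excess≤ k) (∪-assoc ⁅ e ⁆ (listSet l) H) excess))

  peelable⇒⊓≡1 : ∀ {x l} → r N X ≡ 2 → x ∈ X → OutsideClosure N H x → Peelable l →
                 r N Eₛ ≤ suc (r N (listSet l ∪ H)) → ⊓ N X H ≡ 1
  peelable⇒⊓≡1 {x} rX≡2 x∈X x∉clH peelable rE≤ = begin
    r N X + r N H ∸ r N (X ∪ H) ≡⟨ cong₂ (λ a b → a + r N H ∸ b) rX≡2 rX∪H≡ ⟩
    2 + r N H ∸ suc (r N H)     ≡⟨ m+n∸n≡m 1 (r N H) ⟩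
    1                           ∎
    where
    open ≡-Reasoning
    rX∪H≡ : r N (X ∪ H) ≡ suc (r N H)
    rX∪H≡ = ≤-antisym (peel-excess 1 peelable (≤-trans (r-mono N _ _ ⊆⊤) rE≤))
                      (≤-trans x∉clH (r-mono N _ _ (∪-⊆ (⁅⁆-⊆ (∪-introˡ x∈X)) ∪-introʳ)))

module _ {n : ℕ} (N : Matroid n) (H : Subset n) where

  -- When a fan is peeled from the front, the elements at odd positions are spanned by the triangles
  -- they start; the last of them starts none and must be spanned by H and the elements after it.
  SpannedEnd : List (Fin n) → Set
  SpannedEnd []              = ⊤
  SpannedEnd (x ∷ [])        = InClosure N (listSet [] ∪ H) x
  SpannedEnd (x ∷ y ∷ [])    = InClosure N (listSet (y ∷ []) ∪ H) x
  SpannedEnd (_ ∷ _ ∷ z ∷ t) = SpannedEnd (z ∷ t)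

  spannedEnd-even : ∀ {y z} x w mid → 2 ∣ length (x ∷ w ∷ mid ++ y ∷ z ∷ []) →
                    InClosure N (listSet (z ∷ []) ∪ H) y → SpannedEnd (x ∷ w ∷ mid ++ y ∷ z ∷ [])
  spannedEnd-even _ _ []            _    y-spanned = y-spanned
  spannedEnd-even _ _ (_ ∷ [])      even _         = contradiction (2∣2+n⇒2∣n (2∣2+n⇒2∣n even)) 2∤1
  spannedEnd-even _ _ (a ∷ b ∷ mid) even y-spanned = spannedEnd-even a b mid (2∣2+n⇒2∣n even) y-spanned

  spannedEnd-odd : ∀ {y z} p x mid → 2 ∣ length (p ∷ x ∷ mid ++ y ∷ z ∷ []) →
                   InClosure N (listSet [] ∪ H) z → SpannedEnd (x ∷ mid ++ y ∷ z ∷ [])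
  spannedEnd-odd _ _ []            _    z-spanned = z-spanned
  spannedEnd-odd _ _ (_ ∷ [])      even _         = contradiction (2∣2+n⇒2∣n (2∣2+n⇒2∣n even)) 2∤1
  spannedEnd-odd _ _ (a ∷ b ∷ mid) even z-spanned = spannedEnd-odd a b mid (2∣2+n⇒2∣n even) z-spanned

module _ {n : ℕ} (N : Matroid n) (X H : Subset n) where

  altTri-peelable : ∀ x y t → AltTri N (x ∷ y ∷ t) → Unique (x ∷ y ∷ t) → All (_∉ X ∪ H) (x ∷ y ∷ t) →
                     OutsideClosure N (X ∪ (listSet t ∪ H)) y → SpannedEnd N H (x ∷ y ∷ t) →
                     Peelable N X H (x ∷ y ∷ t)
  altTriad-tail-peelable : ∀ p t → AltTriad N (p ∷ t) → Unique (p ∷ t) → All (_∉ X ∪ H) (p ∷ t) →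
                 SpannedEnd N H t → Peelable N X H t

  altTri-peelable x y [] _ _ _ y-free x-spanned = spanned x-spanned (free y-free [])
  altTri-peelable x y (z ∷ t) (xyz , alt) (_ ∷ unique) (_ ∷ avoid) y-free end =
    spanned (circuit⇒InClosure N (proj₁ xyz) (∪-introˡ (x∈⁅x⁆ x)) xyz⊆)
            (free y-free (altTriad-tail-peelable y (z ∷ t) alt unique avoid end))
    where
    xyz⊆ : set3 x y z ⊆ ⁅ x ⁆ ∪ (listSet (y ∷ z ∷ t) ∪ H)
    xyz⊆ = set3-⊆ (∪-introˡ (x∈⁅x⁆ x)) (∪-introʳ (∪-introˡ (∪-introˡ (x∈⁅x⁆ y))))
                  (∪-introʳ (∪-introˡ (∪-introʳ (∪-introˡ (x∈⁅x⁆ z)))))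

  altTriad-tail-peelable _ []          _           _ _ _          = []
  altTriad-tail-peelable _ (_ ∷ [])    _           _ _ x-spanned  = spanned x-spanned []
  altTriad-tail-peelable p (x ∷ y ∷ t) (pxy , alt)
    ((_ ∷ _ ∷ p∉t) ∷ unique@((_ ∷ x∉t) ∷ y∉t ∷ _)) (p∉ ∷ avoid@(x∉ ∷ y∉ ∷ _)) end =
    altTri-peelable x y t alt unique avoid y-free end
    where
    avoids : ∀ {a} → a ∉ X ∪ H → All (a ≢_) t → a ∈ ∁ (X ∪ (listSet t ∪ H))
    avoids a∉ a∉t = x∉p⇒x∈∁p (∉-∪-listSet a∉ a∉t)
    y-free : OutsideClosure N (X ∪ (listSet t ∪ H)) y
    y-free = cocircuit⇒OutsideClosure N (proj₁ pxy) (∪-introʳ (∪-introʳ (x∈⁅x⁆ y)))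
               (set3-⊆ (avoids p∉ p∉t) (avoids x∉ x∉t) (avoids y∉ y∉t))

module _ {n : ℕ} {M : Matroid n} {F H : Subset n} {f′ f : Fin n} where

  end-closures : ∀ {C D} → Circuit M C → f′ ∈ C → C ⊆ ⁅ f′ ⁆ ∪ (H ∪ ⁅ f ⁆) →
                 Cocircuit M D → f ∈ D → D ⊆ H ∪ ⁅ f ⁆ →
                 InClosure M (listSet (f ∷ []) ∪ H) f′ × InClosure (dual M) (listSet [] ∪ H) f
  end-closures circuit f′∈C C⊆ cocircuit f∈D D⊆ =
    circuit⇒InClosure M circuit f′∈C
      (⊆-trans C⊆ (∪-⊆ ∪-introˡ (∪-⊆ (∪-introʳ ∘ ∪-introʳ) (⁅⁆-⊆ f∈)))) ,
    circuit⇒InClosure (dual M) cocircuit f∈D (⊆-trans D⊆ (∪-⊆ (∪-introʳ ∘ ∪-introʳ) ∪-introˡ))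
    where
    f∈ : f ∈ ⁅ f′ ⁆ ∪ (listSet (f ∷ []) ∪ H)
    f∈ = ∪-introʳ (∪-introˡ (∪-introˡ (x∈⁅x⁆ f)))

  right-end-closures : RightFanEnd M F f′ f H ⊎ RightQuadEnd M F f′ f H ⊎ RightTriadEnd M F f′ f H →
                       InClosure M (listSet (f ∷ []) ∪ H) f′ × InClosure (dual M) (listSet [] ∪ H) f
  right-end-closures (inj₁ (_ , h₂ , h₃ , h₄ , h₅ , _ , _ , H∪f≡ , triad , circuit))
    with listSet⇒All (f ∷ h₂ ∷ h₃ ∷ h₄ ∷ h₅ ∷ []) (subst (_ ∈_) (sym H∪f≡))
  ... | f∈ ∷ h₂∈ ∷ h₃∈ ∷ _ ∷ h₅∈ ∷ [] =
    end-closures circuit (∪-introˡ (x∈⁅x⁆ f′))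
      (set4-⊆ (∪-introˡ (x∈⁅x⁆ f′)) (∪-introʳ f∈) (∪-introʳ h₃∈) (∪-introʳ h₅∈))
      (proj₁ triad) (∪-introˡ (x∈⁅x⁆ f)) (set3-⊆ f∈ h₂∈ h₃∈)
  right-end-closures (inj₂ (inj₁ (_ , c₁ , c₂ , d₁ , d₂ , H≡ , _ , triad , _ , _ , _ , circuit , _))) =
    end-closures circuit (∪-introˡ (x∈⁅x⁆ f′))
      (set4-⊆ (∪-introˡ (x∈⁅x⁆ f′)) (∪-introʳ f∈) (∪-introʳ c₁∈) (∪-introʳ d₁∈))
      (proj₁ triad) (∪-introˡ (x∈⁅x⁆ f)) (set3-⊆ f∈ c₁∈ c₂∈)
    where
    inH : ∀ {z} → z ∈ set4 c₁ c₂ d₁ d₂ → z ∈ H ∪ ⁅ f ⁆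
    inH z∈ = ∪-introˡ (subst (_ ∈_) (sym H≡) z∈)
    f∈ : f ∈ H ∪ ⁅ f ⁆
    f∈ = ∪-introʳ (x∈⁅x⁆ f)
    c₁∈ : c₁ ∈ H ∪ ⁅ f ⁆
    c₁∈ = inH (∪-introˡ (x∈⁅x⁆ c₁))
    c₂∈ : c₂ ∈ H ∪ ⁅ f ⁆
    c₂∈ = inH (∪-introʳ (∪-introˡ (x∈⁅x⁆ c₂)))
    d₁∈ : d₁ ∈ H ∪ ⁅ f ⁆
    d₁∈ = inH (∪-introʳ (∪-introʳ (∪-introˡ (x∈⁅x⁆ d₁))))
  right-end-closures (inj₂ (inj₂ (_ , triad , _ , circuit))) =
    end-closures circuit (∪-introʳ (∪-introˡ (x∈⁅x⁆ f′))) (⊆-reflexive (∪-left-comm H ⁅ f′ ⁆ ⁅ f ⁆))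
      (proj₁ triad) (∪-introʳ (x∈⁅x⁆ f)) ⊆-refl

module QuadEnd {n : ℕ} {M : Matroid n} {G F H : Subset n} {e₁ e₂ f′ f : Fin n} {mid : List (Fin n)}
  (G∩F≡∅ : Disjoint M G F) (G∩H≡∅ : Disjoint M G H) (F∩H≡∅ : Disjoint M F H)
  (G∪F∪H≡E : G ∪ F ∪ H ≡ Eₛ) (F≡L : F ≡ listSet (fanList M e₁ e₂ mid f′ f))
  (L-unique : Unique (fanList M e₁ e₂ mid f′ f)) (L-alt : AltTri M (fanList M e₁ e₂ mid f′ f))
  (L-even : 2 ∣ length (fanList M e₁ e₂ mid f′ f)) (G-quad : Quad M G)
  (f′-spanned : InClosure M (listSet (f ∷ []) ∪ H) f′)
  (f-cospanned : InClosure (dual M) (listSet [] ∪ H) f)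
  where

  private
    T L : List (Fin n)
    T = mid ++ f′ ∷ f ∷ []
    L = e₁ ∷ e₂ ∷ T

    L⊆F : listSet L ⊆ F
    L⊆F = ⊆-reflexive (sym F≡L)

    ∁G⊆L∪H : ∁ G ⊆ listSet L ∪ H
    ∁G⊆L∪H {z} z∈∁G with x∈p∪q⁻ G (F ∪ H) (subst (z ∈_) (sym G∪F∪H≡E) ∈⊤)
    ... | inj₁ z∈G   = contradiction z∈G (x∈∁p⇒x∉p z∈∁G)
    ... | inj₂ z∈F∪H = [ ∪-introˡ ∘ ⊆-reflexive F≡L , ∪-introʳ ]′ (x∈p∪q⁻ F H z∈F∪H)

    L⊆∁H : listSet L ⊆ ∁ H
    L⊆∁H z∈L = x∉p⇒x∈∁p (∩≡∅⇒∉ F∩H≡∅ (L⊆F z∈L))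

    G⊆∁H : G ⊆ ∁ H
    G⊆∁H z∈G = x∉p⇒x∈∁p (∩≡∅⇒∉ G∩H≡∅ z∈G)

  module Pair {x y u v : Fin n} (G≡X∪Y : G ≡ (⁅ x ⁆ ∪ ⁅ y ⁆) ∪ (⁅ u ⁆ ∪ ⁅ v ⁆)) where

    X : Subset n
    X = ⁅ x ⁆ ∪ ⁅ y ⁆

    private
      X∪Y⊆G : (⁅ x ⁆ ∪ ⁅ y ⁆) ∪ (⁅ u ⁆ ∪ ⁅ v ⁆) ⊆ G
      X∪Y⊆G = ⊆-reflexive (sym G≡X∪Y)

      x∈G : x ∈ G
      x∈G = X∪Y⊆G (∪-introˡ (∪-introˡ (x∈⁅x⁆ x)))
      y∈G : y ∈ G
      y∈G = X∪Y⊆G (∪-introˡ (∪-introʳ (x∈⁅x⁆ y)))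
      u∈G : u ∈ G
      u∈G = X∪Y⊆G (∪-introʳ (∪-introˡ (x∈⁅x⁆ u)))
      v∈G : v ∈ G
      v∈G = X∪Y⊆G (∪-introʳ (∪-introʳ (x∈⁅x⁆ v)))

      X-pair : ∣ X ∣ ≡ 2 × (∀ {z} → z ∈ ⁅ u ⁆ ∪ ⁅ v ⁆ → z ∉ X)
      X-pair = ∣p∪q∣≡4⇒disjoint-pairs X (⁅ u ⁆ ∪ ⁅ v ⁆) (∣⁅x⁆∪⁅y⁆∣≤2 x y) (∣⁅x⁆∪⁅y⁆∣≤2 u v)
                 (subst (λ S → ∣ S ∣ ≡ 4) G≡X∪Y (proj₂ (proj₂ G-quad)))

      u∉X : u ∉ X
      u∉X = proj₂ X-pair (∪-introˡ (x∈⁅x⁆ u))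

      v∉X : v ∉ X
      v∉X = proj₂ X-pair (∪-introʳ (x∈⁅x⁆ v))

      L-avoids : All (_∉ X ∪ H) L
      L-avoids = listSet⇒All L λ z∈L z∈X∪H →
        [ (λ z∈X → ∩≡∅⇒∉ G∩F≡∅ (X∪Y⊆G (∪-introˡ z∈X)) (L⊆F z∈L)) , x∈∁p⇒x∉p (L⊆∁H z∈L) ]′
        (x∈p∪q⁻ X H z∈X∪H)

      fresh : ∀ {z l} → z ∉ X ∪ H → All (z ≢_) l → z ∈ ∁ (X ∪ (listSet l ∪ H))
      fresh z∉X∪H z∉l = x∉p⇒x∈∁p (∉-∪-listSet z∉X∪H z∉l)

      e₁-fresh-e₂T : e₁ ∈ ∁ (X ∪ (listSet (e₂ ∷ T) ∪ H))
      e₁-fresh-e₂T = fresh (All.head L-avoids) (AllPairs.head L-unique)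

      e₁-fresh-T : e₁ ∈ ∁ (X ∪ (listSet T ∪ H))
      e₁-fresh-T = fresh (All.head L-avoids) (All.tail (AllPairs.head L-unique))

      e₂-fresh-T : e₂ ∈ ∁ (X ∪ (listSet T ∪ H))
      e₂-fresh-T = fresh (All.head (All.tail L-avoids)) (AllPairs.head (AllPairs.tail L-unique))

      G-fresh : ∀ {z} l → listSet l ⊆ listSet L → z ∈ G → z ∉ X → z ∈ ∁ (X ∪ (listSet l ∪ H))
      G-fresh {z} l l⊆L z∈G z∉X = x∉p⇒x∈∁p λ z∈ →
        [ z∉X , [ ∩≡∅⇒∉ G∩F≡∅ z∈G ∘ L⊆F ∘ l⊆L , ∩≡∅⇒∉ G∩H≡∅ z∈G ]′ ∘ x∈p∪q⁻ (listSet l) H ]′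
        (x∈p∪q⁻ X _ z∈)

      quad-⊓≡1 : ∀ N → Circuit N G → Cocircuit N G → OutsideClosure N H x → Peelable N X H L →
                 ⊓ N X H ≡ 1
      quad-⊓≡1 N circuit cocircuit x∉clH peelable =
        peelable⇒⊓≡1 N X H rX≡2 (∪-introˡ (x∈⁅x⁆ x)) x∉clH peelable
          (≤-trans (cocircuit-complement N cocircuit u∈G) (s≤s (r-mono N _ _ ∁G⊆L∪H)))
        where
        rX≡2 : r N X ≡ 2
        rX≡2 = trans (proj₂ circuit X ((λ z∈X → X∪Y⊆G (∪-introˡ z∈X)) , u , u∈G , u∉X)) (proj₁ X-pair)

    ⊓≡1 : Cocircuit M (set4 e₁ e₂ x y) → Cocircuit M (set4 e₁ e₂ u v) → ⊓ M X H ≡ 1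
    ⊓≡1 xy-cocircuit uv-cocircuit = quad-⊓≡1 M (proj₁ G-quad) (proj₁ (proj₂ G-quad))
      (cocircuit⇒OutsideClosure M xy-cocircuit (∪-introʳ (∪-introʳ (∪-introˡ (x∈⁅x⁆ x))))
        (set4-⊆ (L⊆∁H (∪-introˡ (x∈⁅x⁆ e₁))) (L⊆∁H (∪-introʳ (∪-introˡ (x∈⁅x⁆ e₂))))
                (G⊆∁H x∈G) (G⊆∁H y∈G)))
      (altTri-peelable M X H e₁ e₂ T L-alt L-unique L-avoids e₂-free
        (spannedEnd-even M H e₁ e₂ mid L-even f′-spanned))
      where
      T⊆L : listSet T ⊆ listSet L
      T⊆L z∈T = ∪-introʳ (∪-introʳ z∈T)
      e₂-free : OutsideClosure M (X ∪ (listSet T ∪ H)) e₂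
      e₂-free = cocircuit⇒OutsideClosure M uv-cocircuit (∪-introʳ (∪-introˡ (x∈⁅x⁆ e₂)))
        (set4-⊆ e₁-fresh-T e₂-fresh-T (G-fresh T T⊆L u∈G u∉X) (G-fresh T T⊆L v∈G v∉X))

    ⊓*≡1 : Triangle M (set3 e₁ x y) → Triangle M (set3 e₁ u v) → ⊓* M X H ≡ 1
    ⊓*≡1 xy-triangle uv-triangle =
      quad-⊓≡1 (dual M) (proj₁ (proj₂ G-quad)) (circuit⇒dual-cocircuit M (proj₁ G-quad))
        (cocircuit⇒OutsideClosure (dual M) (circuit⇒dual-cocircuit M (proj₁ xy-triangle))
          (∪-introʳ (∪-introˡ (x∈⁅x⁆ x))) (set3-⊆ (L⊆∁H (∪-introˡ (x∈⁅x⁆ e₁))) (G⊆∁H x∈G) (G⊆∁H y∈G)))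
        (free e₁-free (altTriad-tail-peelable (dual M) X H e₁ (e₂ ∷ T) (altTri⇒dual-altTriad M L L-alt)
          L-unique L-avoids (spannedEnd-odd (dual M) H e₁ e₂ mid L-even f-cospanned)))
      where
      e₁-free : OutsideClosure (dual M) (X ∪ (listSet (e₂ ∷ T) ∪ H)) e₁
      e₁-free = cocircuit⇒OutsideClosure (dual M) (circuit⇒dual-cocircuit M (proj₁ uv-triangle))
        (∪-introˡ (x∈⁅x⁆ e₁))
        (set3-⊆ e₁-fresh-e₂T (G-fresh (e₂ ∷ T) ∪-introʳ u∈G u∉X) (G-fresh (e₂ ∷ T) ∪-introʳ v∈G v∉X))

lemma2p3 : ∀ {n : ℕ} (M : Matroid n) (G F H : Subset n)
             (e₁ e₂ : Fin n) (mid : List (Fin n)) (f' f : Fin n)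
             (a₁ a₂ b₁ b₂ : Fin n) →
           ThreeConnected M →
           AccordionWith M G F H e₁ e₂ mid f' f →
           LeftQuadEndWith M F e₁ e₂ G a₁ a₂ b₁ b₂ →
           (⊓ M (⁅ a₁ ⁆ ∪ ⁅ b₁ ⁆) H ≡ 1 × ⊓ M (⁅ a₂ ⁆ ∪ ⁅ b₂ ⁆) H ≡ 1) ×
           (⊓* M (⁅ a₁ ⁆ ∪ ⁅ a₂ ⁆) H ≡ 1 × ⊓* M (⁅ b₁ ⁆ ∪ ⁅ b₂ ⁆) H ≡ 1)
lemma2p3 M G F H e₁ e₂ mid f′ f a₁ a₂ b₁ b₂ _
  (G∩F≡∅ , G∩H≡∅ , F∩H≡∅ , G∪F∪H≡E , _ , (_ , L-unique , _) , F≡L , L-alt , _ , L-even , _ , right-end)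
  (_ , G≡ , G-quad , a-triangle , _ , b-triangle , _ , ab₁-cocircuit , ab₂-cocircuit) =
  (Pair.⊓≡1 G≡a₁b₁∪a₂b₂ ab₁-cocircuit ab₂-cocircuit , Pair.⊓≡1 G≡a₂b₂∪a₁b₁ ab₂-cocircuit ab₁-cocircuit) ,
  (Pair.⊓*≡1 G≡a₁a₂∪b₁b₂ a-triangle b-triangle , Pair.⊓*≡1 G≡b₁b₂∪a₁a₂ b-triangle a-triangle)
  where
  open QuadEnd G∩F≡∅ G∩H≡∅ F∩H≡∅ G∪F∪H≡E F≡L L-unique L-alt L-even G-quad
               (proj₁ (right-end-closures right-end)) (proj₂ (right-end-closures right-end))
  G≡a₁a₂∪b₁b₂ : G ≡ (⁅ a₁ ⁆ ∪ ⁅ a₂ ⁆) ∪ (⁅ b₁ ⁆ ∪ ⁅ b₂ ⁆)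
  G≡a₁a₂∪b₁b₂ = trans G≡ (sym (∪-assoc ⁅ a₁ ⁆ ⁅ a₂ ⁆ (⁅ b₁ ⁆ ∪ ⁅ b₂ ⁆)))
  G≡b₁b₂∪a₁a₂ : G ≡ (⁅ b₁ ⁆ ∪ ⁅ b₂ ⁆) ∪ (⁅ a₁ ⁆ ∪ ⁅ a₂ ⁆)
  G≡b₁b₂∪a₁a₂ = trans G≡a₁a₂∪b₁b₂ (∪-comm (⁅ a₁ ⁆ ∪ ⁅ a₂ ⁆) _)
  G≡a₁b₁∪a₂b₂ : G ≡ (⁅ a₁ ⁆ ∪ ⁅ b₁ ⁆) ∪ (⁅ a₂ ⁆ ∪ ⁅ b₂ ⁆)
  G≡a₁b₁∪a₂b₂ = trans G≡a₁a₂∪b₁b₂ (∪-interchange ⁅ a₁ ⁆ ⁅ a₂ ⁆ ⁅ b₁ ⁆ ⁅ b₂ ⁆)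
  G≡a₂b₂∪a₁b₁ : G ≡ (⁅ a₂ ⁆ ∪ ⁅ b₂ ⁆) ∪ (⁅ a₁ ⁆ ∪ ⁅ b₁ ⁆)
  G≡a₂b₂∪a₁b₁ = trans G≡a₁b₁∪a₂b₂ (∪-comm (⁅ a₁ ⁆ ∪ ⁅ b₁ ⁆) _)
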